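{- For all integers $i\geq1$ and $m\geq0$, $$\frac{2i-1}{2m+2}\,\widetilde{f_{i-1}^{m+1}}(x,y)=\bigl\{x^2+y^2-(i+m+1)^2-i^2\bigr\}\widetilde{f_i^m}(x,y)-2\,\widetilde{f_{i+1}^m}(x,y).$$
   Context: For a number or polynomial $\alpha$ and an integer $k\geq0$, $(\alpha)_k=\alpha(\alpha-1)\cdots(\alpha-k+1)$, $(\alpha)_0=1$. For integers $i,m\geq0$ put $$f_i^m(x,y)=\int_0^x t^{2i}(t^2-x^2)^m(t^2-y^2)^m\,dt,$$ and set $p=2m+i$. Then $f_i^m(x,y)=\sum_{0\leq k\leq m}c_{m,i,k}\,x^{2p-2k+1}y^{2k}$ for uniquely determined rational constants $c_{m,i,k}$. Define $$\widetilde{f_i^m}(x,y)=\sum_{0\leq k\leq m}c_{m,i,k}\,(x+p-k)_{2p-2k+1}\,(y+p-m)_k\,(y+m-p+k-1)_k .$$ -}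

module Defs where

open import Data.Nat as ℕ using (ℕ; zero; suc; _∸_)
open import Data.Nat.Combinatorics using (_C_)
open import Data.Integer using (+_)
open import Data.Rational using (ℚ; _+_; _*_; _-_; -_; _/_; 0ℚ; 1ℚ)

⟦_⟧ : ℕ → ℚ
⟦ n ⟧ = + n / 1

sumTo : ℕ → (ℕ → ℚ) → ℚ
sumTo zero    f = f 0
sumTo (suc n) f = sumTo n f + f (suc n)

sgn : ℕ → ℚ
sgn zero    = 1ℚ
sgn (suc k) = - sgn k

ff : ℚ → ℕ → ℚ
ff α zero    = 1ℚ
ff α (suc k) = ff α k * (α - ⟦ k ⟧)

pp : ℕ → ℕ → ℕ
pp m i = 2 ℕ.* m ℕ.+ i

-- c_{m,i,k}: coefficient of x^{2p-2k+1} y^{2k} in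
--   ∫_0^x t^{2i} (t²-x²)^m (t²-y²)^m dt.
-- Expanding (t²-x²)^m = Σ_a C(m,a)(-x²)^a t^{2(m-a)} and
-- (t²-y²)^m = Σ_k C(m,k)(-y²)^k t^{2(m-k)}, the term (a,k) integrates to
--   (-1)^{a+k} C(m,a) C(m,k) x^{2p-2a-2k+1} x^{2a} y^{2k} / (2p-2a-2k+1).
-- Note 2p-2a-2k ≥ 2i ≥ 0 for a,k ≤ m, so truncated subtraction is exact.
c : ℕ → ℕ → ℕ → ℚ
c m i k = sgn k * ⟦ m C k ⟧ *
  sumTo m (λ a → sgn a * ⟦ m C a ⟧ *
    ((+ 1) / suc (2 ℕ.* pp m i ∸ 2 ℕ.* a ∸ 2 ℕ.* k)))

ftilde : ℕ → ℕ → ℚ → ℚ → ℚ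
ftilde m i x y = sumTo m (λ k →
  c m i k
  * ff (x + ⟦ p ∸ k ⟧) (2 ℕ.* p ∸ 2 ℕ.* k ℕ.+ 1)
  * ff (y + ⟦ p ∸ m ⟧) k
  * ff (y + ⟦ m ⟧ - ⟦ p ⟧ + ⟦ k ⟧ - 1ℚ) k)
  where p = pp m i

{-# OPTIONS --safe #-}
-- Integration by parts in t gives
--   (2i − 1)/(2m + 2) · f_{i−1}^{m+1} = (x² + y²) f_i^m − 2 f_{i+1}^m,
-- an identity between the coefficients c_{m,i,k}.  The tilde map is linear but not
-- multiplicative: x² (x+n)_{2n+1} = (x+n+1)_{2n+3} + (n+1)² (x+n)_{2n+1}, y² acts on the
-- y-factor (y+q)_k (y−q+k−1)_k, q = p − m, in the same way with (q−k)² in place of (n+1)²,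
-- and q grows by one from f_i^m to f_{i+1}^m.  Applying the tilde map to the identity
-- therefore leaves correction terms; they telescope in k because
-- (k+1) c_{m,i+1,k+1} = (k−m) c_{m,i,k}, and what survives is the constant −(i+m+1)² − i².
-- Both coefficient identities come from c_{m,i,k} = (−1)^k C(m,k) J(m, m+i−k), where
-- J(m,t) = ∫₀¹ u^{2t} (u²−1)^m du satisfies Pascal's rule in m and
-- (2t+2m+3) J(m,t+1) = (2t+1) J(m,t).

module Submission where

open import Defs
open import Data.Integer as ℤ using (+_)
import Data.Integer.Tactic.RingSolver as ℤ-Solver
open import Data.List using (_∷_; [])
open import Data.Maybe using (Maybe; just; nothing)
open import Data.Nat as ℕ using (ℕ; zero; suc; _≤_; _<_; _∸_; z≤n; s≤s)
open import Data.Nat.Combinatorics using (_C_; nCk+nC[k+1]≡[n+1]C[k+1]; nC1≡n)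
open import Data.Nat.Combinatorics.Specification using (k>n⇒nCk≡0)
open import Data.Nat.Properties
  using (+-suc; +-comm; +-identityʳ; *-zeroʳ; ≤-refl; ≤-trans; m≤n⇒m≤1+n; n≤1+n; m≤m+n;
         m+n∸m≡n; m∸n+n≡m; ∸-+-assoc; +-∸-assoc; *-distribˡ-∸; m≤n⇒∃[o]m+o≡n)
import Data.Nat.Tactic.RingSolver as ℕ-Solver
open import Data.Product using (∃; proj₁; proj₂)
open import Data.Rational using (ℚ; _+_; _*_; _-_; -_; _/_; 0ℚ; 1ℚ; _≟_; fromℚᵘ; toℚᵘ)
import Data.Rational.Properties as ℚ
open import Data.Rational.Unnormalised using (mkℚᵘ; *≡*) renaming (_+_ to _+ᵘ_; _*_ to _*ᵘ_)
import Data.Rational.Unnormalised.Properties as ℚᵘ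
open import Relation.Binary.PropositionalEquality using (_≡_; refl; sym; trans; cong; cong₂; subst; module ≡-Reasoning)
open import Relation.Nullary using (yes; no)
open import Tactic.RingSolver using (solve-∀; solve)
open import Tactic.RingSolver.Core.AlmostCommutativeRing using (AlmostCommutativeRing; fromCommutativeRing)
open ≡-Reasoning

ℚ-ring : AlmostCommutativeRing _ _
ℚ-ring = fromCommutativeRing ℚ.+-*-commutativeRing isZero
  where
  isZero : (p : ℚ) → Maybe (0ℚ ≡ p)
  isZero p with 0ℚ ≟ p
  ... | yes 0≡p = just 0≡p
  ... | no _    = nothing

modulo : ∀ {l r u v : ℚ} → u ≡ v → ∀ a → l ≡ r + a * (u - v) → l ≡ r
modulo {r = r} {u} refl a eq = trans eq (cancel r a u)
  where
  cancel : ∀ r a u → r + a * (u - u) ≡ r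
  cancel = solve-∀ ℚ-ring

fromℚᵘ-homo-+ : ∀ p q → fromℚᵘ (p +ᵘ q) ≡ fromℚᵘ p + fromℚᵘ q
fromℚᵘ-homo-+ p q = sym (begin
  fromℚᵘ p + fromℚᵘ q                           ≡⟨ ℚ.fromℚᵘ-toℚᵘ _ ⟨
  fromℚᵘ (toℚᵘ (fromℚᵘ p + fromℚᵘ q))           ≡⟨ ℚ.fromℚᵘ-cong (ℚ.toℚᵘ-homo-+ (fromℚᵘ p) (fromℚᵘ q)) ⟩
  fromℚᵘ (toℚᵘ (fromℚᵘ p) +ᵘ toℚᵘ (fromℚᵘ q))   ≡⟨ ℚ.fromℚᵘ-cong (ℚᵘ.+-cong (ℚ.toℚᵘ-fromℚᵘ p) (ℚ.toℚᵘ-fromℚᵘ q)) ⟩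
  fromℚᵘ (p +ᵘ q)                               ∎)

fromℚᵘ-homo-* : ∀ p q → fromℚᵘ (p *ᵘ q) ≡ fromℚᵘ p * fromℚᵘ q
fromℚᵘ-homo-* p q = sym (begin
  fromℚᵘ p * fromℚᵘ q                           ≡⟨ ℚ.fromℚᵘ-toℚᵘ _ ⟨
  fromℚᵘ (toℚᵘ (fromℚᵘ p * fromℚᵘ q))           ≡⟨ ℚ.fromℚᵘ-cong (ℚ.toℚᵘ-homo-* (fromℚᵘ p) (fromℚᵘ q)) ⟩
  fromℚᵘ (toℚᵘ (fromℚᵘ p) *ᵘ toℚᵘ (fromℚᵘ q))   ≡⟨ ℚ.fromℚᵘ-cong (ℚᵘ.*-cong (ℚ.toℚᵘ-fromℚᵘ p) (ℚ.toℚᵘ-fromℚᵘ q)) ⟩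
  fromℚᵘ (p *ᵘ q)                               ∎)

-- ⟦ n ⟧ is definitionally fromℚᵘ (mkℚᵘ (+ n) 0).
⟦⟧-suc : ∀ n → ⟦ suc n ⟧ ≡ ⟦ n ⟧ + 1ℚ
⟦⟧-suc n =
  trans (ℚ.fromℚᵘ-cong {mkℚᵘ (+ suc n) 0} {mkℚᵘ (+ n) 0 +ᵘ mkℚᵘ (+ 1) 0} (*≡* (cross (+ n))))
        (fromℚᵘ-homo-+ (mkℚᵘ (+ n) 0) (mkℚᵘ (+ 1) 0))
  where
  cross : ∀ z → (ℤ.1ℤ ℤ.+ z) ℤ.* ℤ.1ℤ ≡ (z ℤ.* ℤ.1ℤ ℤ.+ ℤ.1ℤ ℤ.* ℤ.1ℤ) ℤ.* ℤ.1ℤ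
  cross = ℤ-Solver.solve-∀

⟦⟧-+ : ∀ m n → ⟦ m ℕ.+ n ⟧ ≡ ⟦ m ⟧ + ⟦ n ⟧
⟦⟧-+ zero    n = sym (ℚ.+-identityˡ ⟦ n ⟧)
⟦⟧-+ (suc m) n = begin
  ⟦ suc (m ℕ.+ n) ⟧      ≡⟨ ⟦⟧-suc (m ℕ.+ n) ⟩
  ⟦ m ℕ.+ n ⟧ + 1ℚ       ≡⟨ cong (_+ 1ℚ) (⟦⟧-+ m n) ⟩
  ⟦ m ⟧ + ⟦ n ⟧ + 1ℚ     ≡⟨ swap ⟦ m ⟧ ⟦ n ⟧ ⟩
  ⟦ m ⟧ + 1ℚ + ⟦ n ⟧     ≡⟨ cong (_+ ⟦ n ⟧) (⟦⟧-suc m) ⟨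
  ⟦ suc m ⟧ + ⟦ n ⟧      ∎
  where
  swap : ∀ a b → a + b + 1ℚ ≡ a + 1ℚ + b
  swap = solve-∀ ℚ-ring

⟦⟧-* : ∀ m n → ⟦ m ℕ.* n ⟧ ≡ ⟦ m ⟧ * ⟦ n ⟧
⟦⟧-* zero    n = sym (ℚ.*-zeroˡ ⟦ n ⟧)
⟦⟧-* (suc m) n = begin
  ⟦ n ℕ.+ m ℕ.* n ⟧      ≡⟨ ⟦⟧-+ n (m ℕ.* n) ⟩
  ⟦ n ⟧ + ⟦ m ℕ.* n ⟧    ≡⟨ cong (λ z → ⟦ n ⟧ + z) (⟦⟧-* m n) ⟩
  ⟦ n ⟧ + ⟦ m ⟧ * ⟦ n ⟧  ≡⟨ factor ⟦ m ⟧ ⟦ n ⟧ ⟩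
  (⟦ m ⟧ + 1ℚ) * ⟦ n ⟧   ≡⟨ cong (_* ⟦ n ⟧) (⟦⟧-suc m) ⟨
  ⟦ suc m ⟧ * ⟦ n ⟧      ∎
  where
  factor : ∀ a b → b + a * b ≡ (a + 1ℚ) * b
  factor = solve-∀ ℚ-ring

⟦⟧-∸ : ∀ m n → n ≤ m → ⟦ m ∸ n ⟧ ≡ ⟦ m ⟧ - ⟦ n ⟧
⟦⟧-∸ m n n≤m = begin
  ⟦ m ∸ n ⟧                  ≡⟨ add-sub ⟦ m ∸ n ⟧ ⟦ n ⟧ ⟩
  ⟦ m ∸ n ⟧ + ⟦ n ⟧ - ⟦ n ⟧  ≡⟨ cong (_- ⟦ n ⟧) (⟦⟧-+ (m ∸ n) n) ⟨
  ⟦ m ∸ n ℕ.+ n ⟧ - ⟦ n ⟧    ≡⟨ cong (λ k → ⟦ k ⟧ - ⟦ n ⟧) (m∸n+n≡m n≤m) ⟩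
  ⟦ m ⟧ - ⟦ n ⟧              ∎
  where
  add-sub : ∀ a b → a ≡ a + b - b
  add-sub = solve-∀ ℚ-ring

⟦⟧-1+2* : ∀ n → ⟦ suc (2 ℕ.* n) ⟧ ≡ ⟦ 2 ⟧ * ⟦ n ⟧ + 1ℚ
⟦⟧-1+2* n = trans (⟦⟧-suc (2 ℕ.* n)) (cong (_+ 1ℚ) (⟦⟧-* 2 n))

/-*-⟦suc⟧ : ∀ a n → (+ a / suc n) * ⟦ suc n ⟧ ≡ ⟦ a ⟧
/-*-⟦suc⟧ a n =
  trans (sym (fromℚᵘ-homo-* (mkℚᵘ (+ a) n) (mkℚᵘ (+ suc n) 0)))
        (ℚ.fromℚᵘ-cong {mkℚᵘ (+ a) n *ᵘ mkℚᵘ (+ suc n) 0} {mkℚᵘ (+ a) 0} (*≡* (cross (+ a) (+ suc n))))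
  where
  cross : ∀ z w → z ℤ.* w ℤ.* ℤ.1ℤ ≡ z ℤ.* (w ℤ.* ℤ.1ℤ)
  cross = ℤ-Solver.solve-∀

odd⁻¹ : ℕ → ℚ
odd⁻¹ n = + 1 / suc (2 ℕ.* n)

odd⁻¹-inverse : ∀ n → odd⁻¹ n * (⟦ 2 ⟧ * ⟦ n ⟧ + 1ℚ) ≡ 1ℚ
odd⁻¹-inverse n = trans (cong (odd⁻¹ n *_) (sym (⟦⟧-1+2* n))) (/-*-⟦suc⟧ 1 (2 ℕ.* n))

*-cancelˡ-odd : ∀ n {p q} → (⟦ 2 ⟧ * ⟦ n ⟧ + 1ℚ) * p ≡ (⟦ 2 ⟧ * ⟦ n ⟧ + 1ℚ) * q → p ≡ q
*-cancelˡ-odd n {p} {q} eq = begin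
  p                  ≡⟨ ℚ.*-identityˡ p ⟨
  1ℚ * p             ≡⟨ cong (_* p) (odd⁻¹-inverse n) ⟨
  odd⁻¹ n * o * p    ≡⟨ ℚ.*-assoc (odd⁻¹ n) o p ⟩
  odd⁻¹ n * (o * p)  ≡⟨ cong (odd⁻¹ n *_) eq ⟩
  odd⁻¹ n * (o * q)  ≡⟨ ℚ.*-assoc (odd⁻¹ n) o q ⟨
  odd⁻¹ n * o * q    ≡⟨ cong (_* q) (odd⁻¹-inverse n) ⟩
  1ℚ * q             ≡⟨ ℚ.*-identityˡ q ⟩
  q                  ∎
  where
  o : ℚ
  o = ⟦ 2 ⟧ * ⟦ n ⟧ + 1ℚ

sumTo-cong : ∀ n {f g : ℕ → ℚ} → (∀ k → k ≤ n → f k ≡ g k) → sumTo n f ≡ sumTo n g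
sumTo-cong zero    f≗g = f≗g 0 z≤n
sumTo-cong (suc n) f≗g =
  cong₂ _+_ (sumTo-cong n (λ k k≤n → f≗g k (m≤n⇒m≤1+n k≤n))) (f≗g (suc n) ≤-refl)

sumTo-*ˡ : ∀ n a (f : ℕ → ℚ) → a * sumTo n f ≡ sumTo n (λ k → a * f k)
sumTo-*ˡ zero    a f = refl
sumTo-*ˡ (suc n) a f =
  trans (ℚ.*-distribˡ-+ a (sumTo n f) (f (suc n))) (cong (_+ a * f (suc n)) (sumTo-*ˡ n a f))

sumTo-sub : ∀ n (f g : ℕ → ℚ) → sumTo n (λ k → f k - g k) ≡ sumTo n f - sumTo n g
sumTo-sub zero    f g = refl
sumTo-sub (suc n) f g =
  trans (cong (_+ (f (suc n) - g (suc n))) (sumTo-sub n f g)) (interchange (sumTo n f) (sumTo n g) (f (suc n)) (g (suc n)))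
  where
  interchange : ∀ a b c d → a - b + (c - d) ≡ a + c - (b + d)
  interchange = solve-∀ ℚ-ring

sumTo-head : ∀ n (f : ℕ → ℚ) → sumTo (suc n) f ≡ f 0 + sumTo n (λ k → f (suc k))
sumTo-head zero    f = refl
sumTo-head (suc n) f =
  trans (cong (_+ f (suc (suc n))) (sumTo-head n f)) (ℚ.+-assoc (f 0) _ _)

sumTo-last-zero : ∀ n (f : ℕ → ℚ) → f (suc n) ≡ 0ℚ → sumTo (suc n) f ≡ sumTo n f
sumTo-last-zero n f f[1+n]≡0 =
  trans (cong (λ z → sumTo n f + z) f[1+n]≡0) (ℚ.+-identityʳ (sumTo n f))

sumTo-telescope : ∀ n (f g h : ℕ → ℚ) → (∀ k → k ≤ n → f k ≡ g k + (h (suc k) - h k)) →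
                  sumTo n f ≡ sumTo n g + (h (suc n) - h 0)
sumTo-telescope zero    f g h step = step 0 z≤n
sumTo-telescope (suc n) f g h step = begin
  sumTo n f + f (suc n)
    ≡⟨ cong₂ _+_ (sumTo-telescope n f g h (λ k k≤n → step k (m≤n⇒m≤1+n k≤n)))
                 (step (suc n) ≤-refl) ⟩
  sumTo n g + (h (suc n) - h 0) + (g (suc n) + (h (suc (suc n)) - h (suc n)))
    ≡⟨ collapse (sumTo n g) (h (suc n)) (h 0) (g (suc n)) (h (suc (suc n))) ⟩
  sumTo n g + g (suc n) + (h (suc (suc n)) - h 0)
    ∎
  where
  collapse : ∀ a b c d e → a + (b - c) + (d + (e - b)) ≡ a + d + (e - c)
  collapse = solve-∀ ℚ-ring

zero-*-* : ∀ {u} (a b : ℚ) → u ≡ 0ℚ → u * a * b ≡ 0ℚ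
zero-*-* a b refl = trans (cong (_* b) (ℚ.*-zeroˡ a)) (ℚ.*-zeroˡ b)

-- Alternating binomial sums and the integrals J m t

alternatingSum : ℕ → (ℕ → ℚ) → ℚ
alternatingSum m h = sumTo m (λ a → sgn a * ⟦ m C a ⟧ * h a)

alternatingSum-cong : ∀ m {h h′ : ℕ → ℚ} → (∀ a → h a ≡ h′ a) →
                      alternatingSum m h ≡ alternatingSum m h′
alternatingSum-cong m h≗h′ = sumTo-cong m (λ a _ → cong (sgn a * ⟦ m C a ⟧ *_) (h≗h′ a))

alternatingSum-suc : ∀ m h → alternatingSum (suc m) h ≡ alternatingSum m h - alternatingSum m (λ a → h (suc a))
alternatingSum-suc m h = begin
  sumTo (suc m) F                                      ≡⟨ sumTo-head m F ⟩
  F 0 + sumTo m (λ a → F (suc a))                      ≡⟨ cong (λ z → F 0 + z) (sumTo-cong m (λ a _ → pascal a)) ⟩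
  G 0 + sumTo m (λ a → G (suc a) - G′ a)               ≡⟨ cong (λ z → G 0 + z) (sumTo-sub m (λ a → G (suc a)) G′) ⟩
  G 0 + (sumTo m (λ a → G (suc a)) - sumTo m G′)       ≡⟨ ℚ.+-assoc (G 0) _ _ ⟨
  G 0 + sumTo m (λ a → G (suc a)) - sumTo m G′         ≡⟨ cong (_- sumTo m G′) (sumTo-head m G) ⟨
  sumTo (suc m) G - sumTo m G′                         ≡⟨ cong (_- sumTo m G′) (sumTo-last-zero m G G[1+m]≡0) ⟩
  sumTo m G - sumTo m G′                               ∎
  where
  F G G′ : ℕ → ℚ
  F a  = sgn a * ⟦ suc m C a ⟧ * h a
  G a  = sgn a * ⟦ m C a ⟧ * h a
  G′ a = sgn a * ⟦ m C a ⟧ * h (suc a)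
  G[1+m]≡0 : G (suc m) ≡ 0ℚ
  G[1+m]≡0 = trans (cong (λ z → sgn (suc m) * z * h (suc m)) (cong ⟦_⟧ (k>n⇒nCk≡0 {m} {suc m} ≤-refl)))
                   (trans (cong (_* h (suc m)) (ℚ.*-zeroʳ (sgn (suc m)))) (ℚ.*-zeroˡ (h (suc m))))
  split : ∀ s u v w → - s * (u + v) * w ≡ - s * v * w - s * u * w
  split = solve-∀ ℚ-ring
  pascal : ∀ a → F (suc a) ≡ G (suc a) - G′ a
  pascal a = begin
    - sgn a * ⟦ suc m C suc a ⟧ * h (suc a)              ≡⟨ cong (λ n → - sgn a * ⟦ n ⟧ * h (suc a)) (nCk+nC[k+1]≡[n+1]C[k+1] m a) ⟨
    - sgn a * ⟦ m C a ℕ.+ m C suc a ⟧ * h (suc a)        ≡⟨ cong (λ z → - sgn a * z * h (suc a)) (⟦⟧-+ (m C a) (m C suc a)) ⟩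
    - sgn a * (⟦ m C a ⟧ + ⟦ m C suc a ⟧) * h (suc a)    ≡⟨ split (sgn a) ⟦ m C a ⟧ ⟦ m C suc a ⟧ (h (suc a)) ⟩
    G (suc a) - G′ a                                     ∎

J : ℕ → ℕ → ℚ
J m t = alternatingSum m (λ a → odd⁻¹ (t ℕ.+ m ∸ a))

J-zero : ∀ t → J 0 t ≡ odd⁻¹ t
J-zero t = trans (ℚ.*-identityˡ _) (cong odd⁻¹ (+-identityʳ t))

J-pascal : ∀ m t → J (suc m) t ≡ J m (suc t) - J m t
J-pascal m t = trans (alternatingSum-suc m _)
  (cong₂ _-_ (alternatingSum-cong m (λ a → cong (λ n → odd⁻¹ (n ∸ a)) (+-suc t m)))
             (alternatingSum-cong m (λ a → cong (λ n → odd⁻¹ (n ∸ suc a)) (+-suc t m))))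

J-recurrence : ∀ m t → (⟦ 2 ⟧ * (⟦ t ⟧ + ⟦ m ⟧) + ⟦ 3 ⟧) * J m (suc t) ≡ (⟦ 2 ⟧ * ⟦ t ⟧ + 1ℚ) * J m t
J-recurrence zero t = begin
  (⟦ 2 ⟧ * (⟦ t ⟧ + ⟦ 0 ⟧) + ⟦ 3 ⟧) * J 0 (suc t)
    ≡⟨ cong₂ _*_ (trans (regroup ⟦ t ⟧) (cong (λ T → ⟦ 2 ⟧ * T + 1ℚ) (sym (⟦⟧-suc t)))) (J-zero (suc t)) ⟩
  (⟦ 2 ⟧ * ⟦ suc t ⟧ + 1ℚ) * odd⁻¹ (suc t)    ≡⟨ trans (ℚ.*-comm (⟦ 2 ⟧ * ⟦ suc t ⟧ + 1ℚ) (odd⁻¹ (suc t))) (odd⁻¹-inverse (suc t)) ⟩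
  1ℚ                                          ≡⟨ trans (ℚ.*-comm (⟦ 2 ⟧ * ⟦ t ⟧ + 1ℚ) (odd⁻¹ t)) (odd⁻¹-inverse t) ⟨
  (⟦ 2 ⟧ * ⟦ t ⟧ + 1ℚ) * odd⁻¹ t              ≡⟨ cong (λ z → (⟦ 2 ⟧ * ⟦ t ⟧ + 1ℚ) * z) (J-zero t) ⟨
  (⟦ 2 ⟧ * ⟦ t ⟧ + 1ℚ) * J 0 t                ∎
  where
  regroup : ∀ T → ⟦ 2 ⟧ * (T + ⟦ 0 ⟧) + ⟦ 3 ⟧ ≡ ⟦ 2 ⟧ * (T + 1ℚ) + 1ℚ
  regroup = solve-∀ ℚ-ring
J-recurrence (suc m) t = begin
  (⟦ 2 ⟧ * (⟦ t ⟧ + ⟦ suc m ⟧) + ⟦ 3 ⟧) * J (suc m) (suc t)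
    ≡⟨ cong₂ (λ M J₁ → (⟦ 2 ⟧ * (⟦ t ⟧ + M) + ⟦ 3 ⟧) * J₁) (⟦⟧-suc m) (J-pascal m (suc t)) ⟩
  (⟦ 2 ⟧ * (⟦ t ⟧ + (⟦ m ⟧ + 1ℚ)) + ⟦ 3 ⟧) * (J m (suc (suc t)) - J m (suc t))
    ≡⟨ step ⟦ t ⟧ ⟦ m ⟧ (J m (suc (suc t))) (J m (suc t)) (J m t) IH (J-recurrence m t) ⟩
  (⟦ 2 ⟧ * ⟦ t ⟧ + 1ℚ) * (J m (suc t) - J m t)
    ≡⟨ cong (λ z → (⟦ 2 ⟧ * ⟦ t ⟧ + 1ℚ) * z) (J-pascal m t) ⟨
  (⟦ 2 ⟧ * ⟦ t ⟧ + 1ℚ) * J (suc m) t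
    ∎
  where
  step : ∀ T M a b c →
         (⟦ 2 ⟧ * (T + 1ℚ + M) + ⟦ 3 ⟧) * a ≡ (⟦ 2 ⟧ * (T + 1ℚ) + 1ℚ) * b →
         (⟦ 2 ⟧ * (T + M) + ⟦ 3 ⟧) * b ≡ (⟦ 2 ⟧ * T + 1ℚ) * c →
         (⟦ 2 ⟧ * (T + (M + 1ℚ)) + ⟦ 3 ⟧) * (a - b) ≡ (⟦ 2 ⟧ * T + 1ℚ) * (b - c)
  step T M a b c h₁ h₂ = modulo h₁ 1ℚ (modulo h₂ (- 1ℚ) (solve (T ∷ M ∷ a ∷ b ∷ c ∷ []) ℚ-ring))
  IH : (⟦ 2 ⟧ * (⟦ t ⟧ + 1ℚ + ⟦ m ⟧) + ⟦ 3 ⟧) * J m (suc (suc t)) ≡ (⟦ 2 ⟧ * (⟦ t ⟧ + 1ℚ) + 1ℚ) * J m (suc t)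
  IH = subst (λ T → (⟦ 2 ⟧ * (T + ⟦ m ⟧) + ⟦ 3 ⟧) * J m (suc (suc t)) ≡ (⟦ 2 ⟧ * T + 1ℚ) * J m (suc t))
             (⟦⟧-suc t) (J-recurrence m (suc t))

J-ibp : ∀ m t → (⟦ 2 ⟧ * ⟦ t ⟧ + 1ℚ) * J (suc m) t ≡ - ((⟦ 2 ⟧ * ⟦ m ⟧ + ⟦ 2 ⟧) * J m (suc t))
J-ibp m t = trans (cong (λ z → (⟦ 2 ⟧ * ⟦ t ⟧ + 1ℚ) * z) (J-pascal m t)) (ibp ⟦ t ⟧ ⟦ m ⟧ (J m (suc t)) (J m t) (J-recurrence m t))
  where
  ibp : ∀ T M a b → (⟦ 2 ⟧ * (T + M) + ⟦ 3 ⟧) * a ≡ (⟦ 2 ⟧ * T + 1ℚ) * b →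
        (⟦ 2 ⟧ * T + 1ℚ) * (a - b) ≡ - ((⟦ 2 ⟧ * M + ⟦ 2 ⟧) * a)
  ibp T M a b h = modulo h 1ℚ (solve (T ∷ M ∷ a ∷ b ∷ []) ℚ-ring)

-- The coefficients c m i k

C-absorption : ∀ n k → suc k ℕ.* (n C suc k) ℕ.+ k ℕ.* (n C k) ≡ n ℕ.* (n C k)
C-absorption zero    zero    = refl
C-absorption zero    (suc k) = cong₂ ℕ._+_ (*-zeroʳ (suc (suc k))) (*-zeroʳ (suc k))
C-absorption (suc n) zero    = trans (cong (λ z → 1 ℕ.* z ℕ.+ 0) (nC1≡n (suc n))) (unit (suc n))
  where
  unit : ∀ x → 1 ℕ.* x ℕ.+ 0 ≡ x ℕ.* 1
  unit = ℕ-Solver.solve-∀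
C-absorption (suc n) (suc k) = begin
  suc (suc k) ℕ.* (suc n C suc (suc k)) ℕ.+ suc k ℕ.* (suc n C suc k)
    ≡⟨ cong₂ (λ u v → suc (suc k) ℕ.* u ℕ.+ suc k ℕ.* v)
             (sym (nCk+nC[k+1]≡[n+1]C[k+1] n (suc k))) (sym (nCk+nC[k+1]≡[n+1]C[k+1] n k)) ⟩
  suc (suc k) ℕ.* (b ℕ.+ b′) ℕ.+ suc k ℕ.* (a ℕ.+ b)
    ≡⟨ regroup k a b b′ ⟩
  (suc (suc k) ℕ.* b′ ℕ.+ suc k ℕ.* b) ℕ.+ (suc k ℕ.* b ℕ.+ k ℕ.* a) ℕ.+ (a ℕ.+ b)
    ≡⟨ cong₂ (λ u v → u ℕ.+ v ℕ.+ (a ℕ.+ b)) (C-absorption n (suc k)) (C-absorption n k) ⟩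
  n ℕ.* b ℕ.+ n ℕ.* a ℕ.+ (a ℕ.+ b)
    ≡⟨ collect n a b ⟩
  suc n ℕ.* (a ℕ.+ b)
    ≡⟨ cong (suc n ℕ.*_) (nCk+nC[k+1]≡[n+1]C[k+1] n k) ⟩
  suc n ℕ.* (suc n C suc k)
    ∎
  where
  a b b′ : ℕ
  a  = n C k
  b  = n C suc k
  b′ = n C suc (suc k)
  regroup : ∀ k a b c → suc (suc k) ℕ.* (b ℕ.+ c) ℕ.+ suc k ℕ.* (a ℕ.+ b)
                        ≡ (suc (suc k) ℕ.* c ℕ.+ suc k ℕ.* b) ℕ.+ (suc k ℕ.* b ℕ.+ k ℕ.* a) ℕ.+ (a ℕ.+ b)
  regroup = ℕ-Solver.solve-∀
  collect : ∀ n a b → n ℕ.* b ℕ.+ n ℕ.* a ℕ.+ (a ℕ.+ b) ≡ suc n ℕ.* (a ℕ.+ b)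
  collect = ℕ-Solver.solve-∀

C-absorptionℚ : ∀ n k → (⟦ k ⟧ + 1ℚ) * ⟦ n C suc k ⟧ ≡ (⟦ n ⟧ - ⟦ k ⟧) * ⟦ n C k ⟧
C-absorptionℚ n k = isolate ⟦ n ⟧ ⟦ k ⟧ ⟦ n C k ⟧ ⟦ n C suc k ⟧ (begin
  (⟦ k ⟧ + 1ℚ) * ⟦ n C suc k ⟧ + ⟦ k ⟧ * ⟦ n C k ⟧
    ≡⟨ cong₂ (λ u v → u * ⟦ n C suc k ⟧ + v) (⟦⟧-suc k) (⟦⟧-* k (n C k)) ⟨
  ⟦ suc k ⟧ * ⟦ n C suc k ⟧ + ⟦ k ℕ.* (n C k) ⟧
    ≡⟨ cong (_+ ⟦ k ℕ.* (n C k) ⟧) (⟦⟧-* (suc k) (n C suc k)) ⟨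
  ⟦ suc k ℕ.* (n C suc k) ⟧ + ⟦ k ℕ.* (n C k) ⟧
    ≡⟨ ⟦⟧-+ (suc k ℕ.* (n C suc k)) (k ℕ.* (n C k)) ⟨
  ⟦ suc k ℕ.* (n C suc k) ℕ.+ k ℕ.* (n C k) ⟧
    ≡⟨ cong ⟦_⟧ (C-absorption n k) ⟩
  ⟦ n ℕ.* (n C k) ⟧
    ≡⟨ ⟦⟧-* n (n C k) ⟩
  ⟦ n ⟧ * ⟦ n C k ⟧
    ∎)
  where
  isolate : ∀ N K C₀ C₁ → (K + 1ℚ) * C₁ + K * C₀ ≡ N * C₀ → (K + 1ℚ) * C₁ ≡ (N - K) * C₀
  isolate N K C₀ C₁ h = modulo h 1ℚ (solve (N ∷ K ∷ C₀ ∷ C₁ ∷ []) ℚ-ring)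

c-as-J : ∀ m i k t → k ℕ.+ t ≡ m ℕ.+ i → c m i k ≡ sgn k * ⟦ m C k ⟧ * J m t
c-as-J m i k t k+t≡m+i =
  cong (sgn k * ⟦ m C k ⟧ *_) (alternatingSum-cong m (λ a → cong (λ n → + 1 / suc n) (exponent a)))
  where
  p≡k+[t+m] : pp m i ≡ k ℕ.+ (t ℕ.+ m)
  p≡k+[t+m] = begin
    2 ℕ.* m ℕ.+ i      ≡⟨ double m i ⟩
    m ℕ.+ (m ℕ.+ i)    ≡⟨ cong (m ℕ.+_) k+t≡m+i ⟨
    m ℕ.+ (k ℕ.+ t)    ≡⟨ rotate m k t ⟩
    k ℕ.+ (t ℕ.+ m)    ∎
    where
    double : ∀ m i → 2 ℕ.* m ℕ.+ i ≡ m ℕ.+ (m ℕ.+ i)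
    double = ℕ-Solver.solve-∀
    rotate : ∀ m k t → m ℕ.+ (k ℕ.+ t) ≡ k ℕ.+ (t ℕ.+ m)
    rotate = ℕ-Solver.solve-∀
  exponent : ∀ a → 2 ℕ.* pp m i ∸ 2 ℕ.* a ∸ 2 ℕ.* k ≡ 2 ℕ.* (t ℕ.+ m ∸ a)
  exponent a = begin
    2 ℕ.* pp m i ∸ 2 ℕ.* a ∸ 2 ℕ.* k      ≡⟨ ∸-+-assoc (2 ℕ.* pp m i) (2 ℕ.* a) (2 ℕ.* k) ⟩
    2 ℕ.* pp m i ∸ (2 ℕ.* a ℕ.+ 2 ℕ.* k)  ≡⟨ cong (2 ℕ.* pp m i ∸_) (+-comm (2 ℕ.* a) (2 ℕ.* k)) ⟩
    2 ℕ.* pp m i ∸ (2 ℕ.* k ℕ.+ 2 ℕ.* a)  ≡⟨ ∸-+-assoc (2 ℕ.* pp m i) (2 ℕ.* k) (2 ℕ.* a) ⟨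
    2 ℕ.* pp m i ∸ 2 ℕ.* k ∸ 2 ℕ.* a      ≡⟨ cong (_∸ 2 ℕ.* a) (*-distribˡ-∸ 2 (pp m i) k) ⟨
    2 ℕ.* (pp m i ∸ k) ∸ 2 ℕ.* a          ≡⟨ *-distribˡ-∸ 2 (pp m i ∸ k) a ⟨
    2 ℕ.* (pp m i ∸ k ∸ a)                ≡⟨ cong (λ n → 2 ℕ.* (n ∸ k ∸ a)) p≡k+[t+m] ⟩
    2 ℕ.* (k ℕ.+ (t ℕ.+ m) ∸ k ∸ a)       ≡⟨ cong (λ n → 2 ℕ.* (n ∸ a)) (m+n∸m≡n k (t ℕ.+ m)) ⟩
    2 ℕ.* (t ℕ.+ m ∸ a)                   ∎

c-vanishes : ∀ m i k → m < k → c m i k ≡ 0ℚ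
c-vanishes m i k m<k = begin
  sgn k * ⟦ m C k ⟧ * S  ≡⟨ cong (λ n → sgn k * ⟦ n ⟧ * S) (k>n⇒nCk≡0 m<k) ⟩
  sgn k * 0ℚ * S         ≡⟨ cong (_* S) (ℚ.*-zeroʳ (sgn k)) ⟩
  0ℚ * S                 ≡⟨ ℚ.*-zeroˡ S ⟩
  0ℚ                     ∎
  where
  S : ℚ
  S = sumTo m (λ a → sgn a * ⟦ m C a ⟧ * (+ 1 / suc (2 ℕ.* pp m i ∸ 2 ℕ.* a ∸ 2 ℕ.* k)))

c-absorption-J : ∀ m i k t → k ℕ.+ t ≡ m ℕ.+ i →
                 (⟦ k ⟧ + 1ℚ) * c m (suc i) (suc k) ≡ (⟦ k ⟧ - ⟦ m ⟧) * c m i k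
c-absorption-J m i k t k+t≡m+i = begin
  (⟦ k ⟧ + 1ℚ) * c m (suc i) (suc k)
    ≡⟨ cong ((⟦ k ⟧ + 1ℚ) *_) (c-as-J m (suc i) (suc k) t (trans (cong suc k+t≡m+i) (sym (+-suc m i)))) ⟩
  (⟦ k ⟧ + 1ℚ) * (- sgn k * ⟦ m C suc k ⟧ * J m t)
    ≡⟨ absorb ⟦ k ⟧ ⟦ m ⟧ (sgn k) ⟦ m C k ⟧ ⟦ m C suc k ⟧ (J m t) (C-absorptionℚ m k) ⟩
  (⟦ k ⟧ - ⟦ m ⟧) * (sgn k * ⟦ m C k ⟧ * J m t)
    ≡⟨ cong ((⟦ k ⟧ - ⟦ m ⟧) *_) (c-as-J m i k t k+t≡m+i) ⟨
  (⟦ k ⟧ - ⟦ m ⟧) * c m i k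
    ∎
  where
  absorb : ∀ K M s C₀ C₁ S → (K + 1ℚ) * C₁ ≡ (M - K) * C₀ →
           (K + 1ℚ) * (- s * C₁ * S) ≡ (K - M) * (s * C₀ * S)
  absorb K M s C₀ C₁ S h = modulo h (- s * S) (solve (K ∷ M ∷ s ∷ C₀ ∷ C₁ ∷ S ∷ []) ℚ-ring)

c-absorption : ∀ m i k → k ≤ m ℕ.+ i → (⟦ k ⟧ + 1ℚ) * c m (suc i) (suc k) ≡ (⟦ k ⟧ - ⟦ m ⟧) * c m i k
c-absorption m i k k≤m+i = c-absorption-J m i k (proj₁ k+t≡m+i) (proj₂ k+t≡m+i)
  where
  k+t≡m+i : ∃ λ t → k ℕ.+ t ≡ m ℕ.+ i
  k+t≡m+i = m≤n⇒∃[o]m+o≡n k≤m+i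

ratio : ℕ → ℕ → ℚ
ratio m i = + (2 ℕ.* i ∸ 1) / suc (suc (2 ℕ.* m))

ratio-* : ∀ m j → ratio m (suc j) * (⟦ 2 ⟧ * ⟦ m ⟧ + ⟦ 2 ⟧) ≡ ⟦ 2 ⟧ * ⟦ j ⟧ + 1ℚ
ratio-* m j = begin
  ratio m (suc j) * (⟦ 2 ⟧ * ⟦ m ⟧ + ⟦ 2 ⟧)  ≡⟨ cong (ratio m (suc j) *_) denominator ⟨
  ratio m (suc j) * ⟦ suc (suc (2 ℕ.* m)) ⟧  ≡⟨ /-*-⟦suc⟧ (2 ℕ.* suc j ∸ 1) (suc (2 ℕ.* m)) ⟩
  ⟦ 2 ℕ.* suc j ∸ 1 ⟧                        ≡⟨ cong ⟦_⟧ (+-suc j (j ℕ.+ 0)) ⟩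
  ⟦ suc (2 ℕ.* j) ⟧                          ≡⟨ ⟦⟧-1+2* j ⟩
  ⟦ 2 ⟧ * ⟦ j ⟧ + 1ℚ                         ∎
  where
  plus-one : ∀ a → a + 1ℚ + 1ℚ ≡ a + ⟦ 2 ⟧
  plus-one = solve-∀ ℚ-ring
  denominator : ⟦ suc (suc (2 ℕ.* m)) ⟧ ≡ ⟦ 2 ⟧ * ⟦ m ⟧ + ⟦ 2 ⟧
  denominator = trans (⟦⟧-suc (suc (2 ℕ.* m)))
                      (trans (cong (_+ 1ℚ) (⟦⟧-1+2* m)) (plus-one (⟦ 2 ⟧ * ⟦ m ⟧)))

ibp-identity : ∀ ρ s C₀ C₁ J₀ J₁ J₂ M Jj K T →
  Jj ≡ T + K - M - 1ℚ →
  ρ * (⟦ 2 ⟧ * M + ⟦ 2 ⟧) ≡ ⟦ 2 ⟧ * Jj + 1ℚ →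
  (⟦ 2 ⟧ * (T + M) + ⟦ 3 ⟧) * J₁ ≡ (⟦ 2 ⟧ * T + 1ℚ) * J₀ →
  (⟦ 2 ⟧ * T + 1ℚ) * J₂ ≡ - ((⟦ 2 ⟧ * M + ⟦ 2 ⟧) * J₁) →
  K * C₁ ≡ (M + 1ℚ - K) * C₀ →
  (⟦ 2 ⟧ * T + 1ℚ) * (ρ * (- s * (C₀ + C₁) * J₂))
    ≡ (⟦ 2 ⟧ * T + 1ℚ) * (- s * C₁ * J₀ - ⟦ 2 ⟧ * (- s * C₁ * J₁) + s * C₀ * J₁)
ibp-identity ρ s C₀ C₁ J₀ J₁ J₂ M _ K T refl hρ hJ₁ hJ₂ hC =
  modulo hρ (s * (C₀ + C₁) * J₁) (modulo hJ₂ (- s * (C₀ + C₁) * ρ) (modulo hJ₁ (- s * C₁) (modulo hC (⟦ 2 ⟧ * s * J₁)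
    (solve (ρ ∷ s ∷ C₀ ∷ C₁ ∷ J₀ ∷ J₁ ∷ J₂ ∷ M ∷ K ∷ T ∷ []) ℚ-ring))))

J-ibp-coefficients : ∀ m j k t (s C₀ C₁ : ℚ) → t ℕ.+ k ≡ suc (m ℕ.+ j) →
  ⟦ k ⟧ * C₁ ≡ (⟦ m ⟧ + 1ℚ - ⟦ k ⟧) * C₀ →
  ratio m (suc j) * (- s * (C₀ + C₁) * J (suc m) t)
    ≡ - s * C₁ * J m t - ⟦ 2 ⟧ * (- s * C₁ * J m (suc t)) + s * C₀ * J m (suc t)
J-ibp-coefficients m j k t s C₀ C₁ t+k≡1+m+j hC =
  *-cancelˡ-odd t (ibp-identity (ratio m (suc j)) s C₀ C₁ (J m t) (J m (suc t)) (J (suc m) t)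
                              ⟦ m ⟧ ⟦ j ⟧ ⟦ k ⟧ ⟦ t ⟧ ⟦j⟧≡ (ratio-* m j) (J-recurrence m t) (J-ibp m t) hC)
  where
  isolate : ∀ T K M Jj → T + K ≡ M + Jj + 1ℚ → Jj ≡ T + K - M - 1ℚ
  isolate T K M Jj h = modulo h (- 1ℚ) (solve (T ∷ K ∷ M ∷ Jj ∷ []) ℚ-ring)
  ⟦j⟧≡ : ⟦ j ⟧ ≡ ⟦ t ⟧ + ⟦ k ⟧ - ⟦ m ⟧ - 1ℚ
  ⟦j⟧≡ = isolate ⟦ t ⟧ ⟦ k ⟧ ⟦ m ⟧ ⟦ j ⟧ (begin
    ⟦ t ⟧ + ⟦ k ⟧             ≡⟨ ⟦⟧-+ t k ⟨
    ⟦ t ℕ.+ k ⟧               ≡⟨ cong ⟦_⟧ t+k≡1+m+j ⟩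
    ⟦ suc (m ℕ.+ j) ⟧         ≡⟨ ⟦⟧-suc (m ℕ.+ j) ⟩
    ⟦ m ℕ.+ j ⟧ + 1ℚ          ≡⟨ cong (_+ 1ℚ) (⟦⟧-+ m j) ⟩
    ⟦ m ⟧ + ⟦ j ⟧ + 1ℚ        ∎)

-- Multiplication by y² on coefficient sequences of polynomials in y².
shift : (ℕ → ℚ) → ℕ → ℚ
shift f zero    = 0ℚ
shift f (suc k) = f k

c-ibp-suc : ∀ m j k d → k ℕ.+ d ≡ m →
  ratio m (suc j) * c (suc m) j (suc k)
    ≡ c m (suc j) (suc k) - ⟦ 2 ⟧ * c m (suc (suc j)) (suc k) + c m (suc j) k
c-ibp-suc m j k d refl = begin
  ratio m (suc j) * c (suc m) j (suc k)
    ≡⟨ cong (ratio m (suc j) *_) (c-as-J (suc m) j (suc k) t (index-A k d j)) ⟩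
  ratio m (suc j) * (- sgn k * ⟦ suc m C suc k ⟧ * J (suc m) t)
    ≡⟨ cong (λ n → ratio m (suc j) * (- sgn k * ⟦ n ⟧ * J (suc m) t)) (nCk+nC[k+1]≡[n+1]C[k+1] m k) ⟨
  ratio m (suc j) * (- sgn k * ⟦ m C k ℕ.+ m C suc k ⟧ * J (suc m) t)
    ≡⟨ cong (λ z → ratio m (suc j) * (- sgn k * z * J (suc m) t)) (⟦⟧-+ (m C k) (m C suc k)) ⟩
  ratio m (suc j) * (- sgn k * (⟦ m C k ⟧ + ⟦ m C suc k ⟧) * J (suc m) t)
    ≡⟨ J-ibp-coefficients m j (suc k) t (sgn k) ⟦ m C k ⟧ ⟦ m C suc k ⟧ (index-J k d j) absorption ⟩
  - sgn k * ⟦ m C suc k ⟧ * J m t - ⟦ 2 ⟧ * (- sgn k * ⟦ m C suc k ⟧ * J m (suc t))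
    + sgn k * ⟦ m C k ⟧ * J m (suc t)
    ≡⟨ cong₂ _+_ (cong₂ (λ u v → u - ⟦ 2 ⟧ * v)
                        (c-as-J m (suc j) (suc k) t (index-B k d j))
                        (c-as-J m (suc (suc j)) (suc k) (suc t) (index-D k d j)))
                 (c-as-J m (suc j) k (suc t) (index-B₋ k d j)) ⟨
  c m (suc j) (suc k) - ⟦ 2 ⟧ * c m (suc (suc j)) (suc k) + c m (suc j) k
    ∎
  where
  t : ℕ
  t = d ℕ.+ j
  index-A : ∀ k d j → suc k ℕ.+ (d ℕ.+ j) ≡ suc (k ℕ.+ d) ℕ.+ j
  index-A = ℕ-Solver.solve-∀
  index-J : ∀ k d j → d ℕ.+ j ℕ.+ suc k ≡ suc (k ℕ.+ d ℕ.+ j)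
  index-J = ℕ-Solver.solve-∀
  index-B : ∀ k d j → suc k ℕ.+ (d ℕ.+ j) ≡ k ℕ.+ d ℕ.+ suc j
  index-B = ℕ-Solver.solve-∀
  index-D : ∀ k d j → suc k ℕ.+ suc (d ℕ.+ j) ≡ k ℕ.+ d ℕ.+ suc (suc j)
  index-D = ℕ-Solver.solve-∀
  index-B₋ : ∀ k d j → k ℕ.+ suc (d ℕ.+ j) ≡ k ℕ.+ d ℕ.+ suc j
  index-B₋ = ℕ-Solver.solve-∀
  shift-by-one : ∀ M K → M - K ≡ M + 1ℚ - (K + 1ℚ)
  shift-by-one = solve-∀ ℚ-ring
  absorption : ⟦ suc k ⟧ * ⟦ m C suc k ⟧ ≡ (⟦ m ⟧ + 1ℚ - ⟦ suc k ⟧) * ⟦ m C k ⟧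
  absorption = begin
    ⟦ suc k ⟧ * ⟦ m C suc k ⟧               ≡⟨ cong (_* ⟦ m C suc k ⟧) (⟦⟧-suc k) ⟩
    (⟦ k ⟧ + 1ℚ) * ⟦ m C suc k ⟧            ≡⟨ C-absorptionℚ m k ⟩
    (⟦ m ⟧ - ⟦ k ⟧) * ⟦ m C k ⟧             ≡⟨ cong (_* ⟦ m C k ⟧) (shift-by-one ⟦ m ⟧ ⟦ k ⟧) ⟩
    (⟦ m ⟧ + 1ℚ - (⟦ k ⟧ + 1ℚ)) * ⟦ m C k ⟧ ≡⟨ cong (λ z → (⟦ m ⟧ + 1ℚ - z) * ⟦ m C k ⟧) (⟦⟧-suc k) ⟨
    (⟦ m ⟧ + 1ℚ - ⟦ suc k ⟧) * ⟦ m C k ⟧    ∎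

c-ibp : ∀ m j k → k ≤ suc m →
  ratio m (suc j) * c (suc m) j k ≡ c m (suc j) k - ⟦ 2 ⟧ * c m (suc (suc j)) k + shift (c m (suc j)) k
c-ibp m j zero _ = begin
  ratio m (suc j) * c (suc m) j 0
    ≡⟨ cong (ratio m (suc j) *_) (c-as-J (suc m) j 0 t refl) ⟩
  -- C(m, −1) = 0: take C₀ = 0, C₁ = C(m, 0) = 1, and s = −1 so that − s = sgn 0.
  ratio m (suc j) * (- (- 1ℚ) * (0ℚ + 1ℚ) * J (suc m) t)
    ≡⟨ J-ibp-coefficients m j 0 t (- 1ℚ) 0ℚ 1ℚ (+-identityʳ t) (sym (ℚ.*-zeroʳ (⟦ m ⟧ + 1ℚ - 0ℚ))) ⟩
  1ℚ * J m t - ⟦ 2 ⟧ * (1ℚ * J m (suc t)) + - 1ℚ * 0ℚ * J m (suc t)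
    ≡⟨ cong₂ _+_ (cong₂ (λ u v → u - ⟦ 2 ⟧ * v)
                        (c-as-J m (suc j) 0 t (sym (+-suc m j)))
                        (c-as-J m (suc (suc j)) 0 (suc t) (sym (trans (+-suc m (suc j)) (cong suc (+-suc m j))))))
                 (sym (ℚ.*-zeroˡ (J m (suc t)))) ⟨
  c m (suc j) 0 - ⟦ 2 ⟧ * c m (suc (suc j)) 0 + 0ℚ
    ∎
  where
  t : ℕ
  t = suc (m ℕ.+ j)

c-ibp m j (suc k) (s≤s k≤m) = c-ibp-suc m j k (proj₁ k+d≡m) (proj₂ k+d≡m)
  where
  k+d≡m : ∃ λ d → k ℕ.+ d ≡ m
  k+d≡m = m≤n⇒∃[o]m+o≡n k≤m

-- Falling factorials

ff-sucˡ : ∀ α k → ff (α + 1ℚ) (suc k) ≡ (α + 1ℚ) * ff α k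
ff-sucˡ α zero    = trans (ℚ.*-identityˡ (α + 1ℚ - 0ℚ)) (trans (ℚ.+-identityʳ (α + 1ℚ)) (sym (ℚ.*-identityʳ (α + 1ℚ))))
ff-sucˡ α (suc k) = begin
  ff (α + 1ℚ) (suc k) * (α + 1ℚ - ⟦ suc k ⟧)    ≡⟨ cong₂ (λ u v → u * (α + 1ℚ - v)) (ff-sucˡ α k) (⟦⟧-suc k) ⟩
  (α + 1ℚ) * ff α k * (α + 1ℚ - (⟦ k ⟧ + 1ℚ))   ≡⟨ regroup α (ff α k) ⟦ k ⟧ ⟩
  (α + 1ℚ) * (ff α k * (α - ⟦ k ⟧))             ∎
  where
  regroup : ∀ a f k → (a + 1ℚ) * f * (a + 1ℚ - (k + 1ℚ)) ≡ (a + 1ℚ) * (f * (a - k))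
  regroup = solve-∀ ℚ-ring

tildeX : ℕ → ℚ → ℚ
tildeX n x = ff (x + ⟦ n ⟧) (2 ℕ.* n ℕ.+ 1)

tildeX-suc : ∀ n x → tildeX (suc n) x ≡ (x * x - (⟦ n ⟧ + 1ℚ) * (⟦ n ⟧ + 1ℚ)) * tildeX n x
tildeX-suc n x = begin
  ff (x + ⟦ suc n ⟧) (2 ℕ.* suc n ℕ.+ 1)
    ≡⟨ cong₂ ff (trans (cong (λ z → x + z) (⟦⟧-suc n)) (sym (ℚ.+-assoc x ⟦ n ⟧ 1ℚ))) (length n) ⟩
  ff (x + ⟦ n ⟧ + 1ℚ) (suc (2 ℕ.* n ℕ.+ 1)) * (x + ⟦ n ⟧ + 1ℚ - ⟦ suc (2 ℕ.* n ℕ.+ 1) ⟧)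
    ≡⟨ cong₂ _*_ (ff-sucˡ (x + ⟦ n ⟧) (2 ℕ.* n ℕ.+ 1)) (cong (λ z → x + ⟦ n ⟧ + 1ℚ - z) last) ⟩
  (x + ⟦ n ⟧ + 1ℚ) * tildeX n x * (x + ⟦ n ⟧ + 1ℚ - (⟦ 2 ⟧ * ⟦ n ⟧ + 1ℚ + 1ℚ))
    ≡⟨ difference-of-squares x ⟦ n ⟧ (tildeX n x) ⟩
  (x * x - (⟦ n ⟧ + 1ℚ) * (⟦ n ⟧ + 1ℚ)) * tildeX n x
    ∎
  where
  length : ∀ n → 2 ℕ.* suc n ℕ.+ 1 ≡ suc (suc (2 ℕ.* n ℕ.+ 1))
  length = ℕ-Solver.solve-∀
  last : ⟦ suc (2 ℕ.* n ℕ.+ 1) ⟧ ≡ ⟦ 2 ⟧ * ⟦ n ⟧ + 1ℚ + 1ℚ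
  last = trans (⟦⟧-suc (2 ℕ.* n ℕ.+ 1)) (cong (_+ 1ℚ) (trans (⟦⟧-+ (2 ℕ.* n) 1) (cong (_+ 1ℚ) (⟦⟧-* 2 n))))
  difference-of-squares : ∀ x n X → (x + n + 1ℚ) * X * (x + n + 1ℚ - (⟦ 2 ⟧ * n + 1ℚ + 1ℚ))
                                    ≡ (x * x - (n + 1ℚ) * (n + 1ℚ)) * X
  difference-of-squares = solve-∀ ℚ-ring

tildeY : ℕ → ℕ → ℚ → ℚ
tildeY q k y = ff (y + ⟦ q ⟧) k * ff (y - ⟦ q ⟧ + ⟦ k ⟧ - 1ℚ) k

tildeY-suc : ∀ q k y → tildeY q (suc k) y ≡ (y * y - (⟦ q ⟧ - ⟦ k ⟧) * (⟦ q ⟧ - ⟦ k ⟧)) * tildeY q k y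
tildeY-suc q k y = begin
  ff (y + ⟦ q ⟧) k * (y + ⟦ q ⟧ - ⟦ k ⟧) * ff (y - ⟦ q ⟧ + ⟦ suc k ⟧ - 1ℚ) (suc k)
    ≡⟨ cong (λ z → ff (y + ⟦ q ⟧) k * (y + ⟦ q ⟧ - ⟦ k ⟧) * ff z (suc k)) (trans (cong (λ z → y - ⟦ q ⟧ + z - 1ℚ) (⟦⟧-suc k)) (reassociate y ⟦ q ⟧ ⟦ k ⟧)) ⟩
  ff (y + ⟦ q ⟧) k * (y + ⟦ q ⟧ - ⟦ k ⟧) * ff (β + 1ℚ) (suc k)
    ≡⟨ cong (ff (y + ⟦ q ⟧) k * (y + ⟦ q ⟧ - ⟦ k ⟧) *_) (ff-sucˡ β k) ⟩
  ff (y + ⟦ q ⟧) k * (y + ⟦ q ⟧ - ⟦ k ⟧) * ((β + 1ℚ) * ff β k)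
    ≡⟨ difference-of-squares y ⟦ q ⟧ ⟦ k ⟧ (ff (y + ⟦ q ⟧) k) (ff β k) ⟩
  (y * y - (⟦ q ⟧ - ⟦ k ⟧) * (⟦ q ⟧ - ⟦ k ⟧)) * tildeY q k y
    ∎
  where
  β : ℚ
  β = y - ⟦ q ⟧ + ⟦ k ⟧ - 1ℚ
  reassociate : ∀ y q k → y - q + (k + 1ℚ) - 1ℚ ≡ y - q + k - 1ℚ + 1ℚ
  reassociate = solve-∀ ℚ-ring
  difference-of-squares : ∀ y q k f g → f * (y + q - k) * ((y - q + k - 1ℚ + 1ℚ) * g)
                                       ≡ (y * y - (q - k) * (q - k)) * (f * g)
  difference-of-squares = solve-∀ ℚ-ring

tildeY-suc-suc : ∀ q k y → tildeY (suc q) (suc k) y ≡ (y * y - (⟦ q ⟧ + 1ℚ) * (⟦ q ⟧ + 1ℚ)) * tildeY q k y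
tildeY-suc-suc q k y = begin
  ff (y + ⟦ suc q ⟧) (suc k) * ff (y - ⟦ suc q ⟧ + ⟦ suc k ⟧ - 1ℚ) (suc k)
    ≡⟨ cong₂ (λ u v → ff u (suc k) * ff v (suc k))
             (trans (cong (λ z → y + z) (⟦⟧-suc q)) (sym (ℚ.+-assoc y ⟦ q ⟧ 1ℚ)))
             (trans (cong₂ (λ u v → y - u + v - 1ℚ) (⟦⟧-suc q) (⟦⟧-suc k)) (cancel y ⟦ q ⟧ ⟦ k ⟧)) ⟩
  ff (y + ⟦ q ⟧ + 1ℚ) (suc k) * ff β (suc k)
    ≡⟨ cong (_* ff β (suc k)) (ff-sucˡ (y + ⟦ q ⟧) k) ⟩
  (y + ⟦ q ⟧ + 1ℚ) * ff (y + ⟦ q ⟧) k * (ff β k * (β - ⟦ k ⟧))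
    ≡⟨ difference-of-squares y ⟦ q ⟧ ⟦ k ⟧ (ff (y + ⟦ q ⟧) k) (ff β k) ⟩
  (y * y - (⟦ q ⟧ + 1ℚ) * (⟦ q ⟧ + 1ℚ)) * tildeY q k y
    ∎
  where
  β : ℚ
  β = y - ⟦ q ⟧ + ⟦ k ⟧ - 1ℚ
  cancel : ∀ y q k → y - (q + 1ℚ) + (k + 1ℚ) - 1ℚ ≡ y - q + k - 1ℚ
  cancel = solve-∀ ℚ-ring
  difference-of-squares : ∀ y q k f g → (y + q + 1ℚ) * f * (g * (y - q + k - 1ℚ - k))
                                       ≡ (y * y - (q + 1ℚ) * (q + 1ℚ)) * (f * g)
  difference-of-squares = solve-∀ ℚ-ring

ftilde-as-sum : ∀ m i {p q} x y → pp m i ≡ p → pp m i ∸ m ≡ q →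
  ftilde m i x y ≡ sumTo m (λ k → c m i k * tildeX (p ∸ k) x * tildeY q k y)
ftilde-as-sum m i x y refl refl = sumTo-cong m (λ k _ → term k)
  where
  m≤p : m ≤ pp m i
  m≤p = ≤-trans (m≤m+n m (m ℕ.+ 0)) (m≤m+n (2 ℕ.* m) i)
  rearrange : ∀ y m p → y + m - p ≡ y - (p - m)
  rearrange = solve-∀ ℚ-ring
  y+m-p : y + ⟦ m ⟧ - ⟦ pp m i ⟧ ≡ y - ⟦ pp m i ∸ m ⟧
  y+m-p = trans (rearrange y ⟦ m ⟧ ⟦ pp m i ⟧) (cong (λ z → y - z) (sym (⟦⟧-∸ (pp m i) m m≤p)))
  term : ∀ k → c m i k * ff (x + ⟦ pp m i ∸ k ⟧) (2 ℕ.* pp m i ∸ 2 ℕ.* k ℕ.+ 1)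
                 * ff (y + ⟦ pp m i ∸ m ⟧) k * ff (y + ⟦ m ⟧ - ⟦ pp m i ⟧ + ⟦ k ⟧ - 1ℚ) k
               ≡ c m i k * tildeX (pp m i ∸ k) x * tildeY (pp m i ∸ m) k y
  term k = trans
    (cong₂ (λ n z → c m i k * ff (x + ⟦ pp m i ∸ k ⟧) (n ℕ.+ 1) * ff (y + ⟦ pp m i ∸ m ⟧) k * ff (z + ⟦ k ⟧ - 1ℚ) k)
           (sym (*-distribˡ-∸ 2 (pp m i) k)) y+m-p)
    (ℚ.*-assoc (c m i k * tildeX (pp m i ∸ k) x) (ff (y + ⟦ pp m i ∸ m ⟧) k) (ff (y - ⟦ pp m i ∸ m ⟧ + ⟦ k ⟧ - 1ℚ) k))

-- E − (x² − (N+1)²) − (y² − (Q−K)²) = 2(M−K)(2Q+1−K) and (Q−K)² − (Q+1)² = −(K+1)(2Q+1−K).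
multiplier-identity : ∀ x y I M K E N Q B D′ →
  E ≡ x * x + y * y - (I + M + 1ℚ) * (I + M + 1ℚ) - I * I →
  N ≡ ⟦ 2 ⟧ * M + I - K →
  Q ≡ M + I →
  (K + 1ℚ) * D′ ≡ (K - M) * B →
  E * B ≡ B * ((x * x - (N + 1ℚ) * (N + 1ℚ)) + (y * y - (Q - K) * (Q - K)))
          + ⟦ 2 ⟧ * D′ * ((y * y - (Q + 1ℚ) * (Q + 1ℚ)) - (y * y - (Q - K) * (Q - K)))
multiplier-identity x y I M K _ _ _ B D′ refl refl refl h =
  modulo h (⟦ 2 ⟧ * (⟦ 2 ⟧ * (M + I) + 1ℚ - K)) (solve (x ∷ y ∷ I ∷ M ∷ K ∷ B ∷ D′ ∷ []) ℚ-ring)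

telescoping-step : ∀ E ξ η θ ρ A B D D′ Bₛ X X′ Y Y₊ Y⁺ Y⁺₊ →
  X′ ≡ ξ * X → Y₊ ≡ η * Y → Y⁺₊ ≡ θ * Y →
  E * B ≡ B * (ξ + η) + ⟦ 2 ⟧ * D′ * (θ - η) →
  ρ * A ≡ B - ⟦ 2 ⟧ * D + Bₛ →
  E * (B * X * Y) - ⟦ 2 ⟧ * (D * X′ * Y⁺)
    ≡ ρ * (A * X′ * Y) + ((B * X * Y₊ + ⟦ 2 ⟧ * D′ * X * (Y⁺₊ - Y₊)) - (Bₛ * X′ * Y + ⟦ 2 ⟧ * D * X′ * (Y⁺ - Y)))
telescoping-step E ξ η θ ρ A B D D′ Bₛ X _ Y _ Y⁺ _ refl refl refl hE hρ =
  modulo hE (X * Y) (modulo hρ (- (ξ * X * Y))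
    (solve (E ∷ ξ ∷ η ∷ θ ∷ ρ ∷ A ∷ B ∷ D ∷ D′ ∷ Bₛ ∷ X ∷ Y ∷ Y⁺ ∷ []) ℚ-ring))

-- With i = j + 1, Aₜ, Bₜ, Dₜ are the terms of the tilde sums of f_{i−1}^{m+1}, f_i^m, f_{i+1}^m,
-- whose p is P + 1, P, P + 1 and whose p − m is q, q, q + 1.
module Recurrence (m j : ℕ) (x y : ℚ) where

  P q : ℕ
  P = pp m (suc j)
  q = m ℕ.+ suc j

  ρ E : ℚ
  ρ = ratio m (suc j)
  E = x * x + y * y - ⟦ (suc j ℕ.+ m ℕ.+ 1) ℕ.* (suc j ℕ.+ m ℕ.+ 1) ⟧ - ⟦ suc j ℕ.* suc j ⟧

  A B D X X′ Y Y⁺ : ℕ → ℚ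
  A    = c (suc m) j
  B    = c m (suc j)
  D    = c m (suc (suc j))
  X k  = tildeX (P ∸ k) x
  X′ k = tildeX (suc P ∸ k) x
  Y k  = tildeY q k y
  Y⁺ k = tildeY (suc q) k y

  Aₜ Bₜ Dₜ H : ℕ → ℚ
  Aₜ k = A k * X′ k * Y k
  Bₜ k = B k * X k * Y k
  Dₜ k = D k * X′ k * Y⁺ k
  H k  = shift B k * X′ k * Y k + ⟦ 2 ⟧ * D k * X′ k * (Y⁺ k - Y k)

  ∸-≡ : ∀ {a} b c → a ≡ b ℕ.+ c → a ∸ b ≡ c
  ∸-≡ b c refl = m+n∸m≡n b c

  P≡1+m+[m+j] : 2 ℕ.* m ℕ.+ suc j ≡ suc m ℕ.+ (m ℕ.+ j)
  P≡1+m+[m+j] = ℕ-Solver.solve (m ∷ j ∷ [])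
  P≡m+q : 2 ℕ.* m ℕ.+ suc j ≡ m ℕ.+ (m ℕ.+ suc j)
  P≡m+q = ℕ-Solver.solve (m ∷ j ∷ [])
  ppA≡1+P : 2 ℕ.* suc m ℕ.+ j ≡ suc (2 ℕ.* m ℕ.+ suc j)
  ppA≡1+P = ℕ-Solver.solve (m ∷ j ∷ [])
  ppA≡1+m+q : 2 ℕ.* suc m ℕ.+ j ≡ suc m ℕ.+ (m ℕ.+ suc j)
  ppA≡1+m+q = ℕ-Solver.solve (m ∷ j ∷ [])
  ppD≡1+P : 2 ℕ.* m ℕ.+ suc (suc j) ≡ suc (2 ℕ.* m ℕ.+ suc j)
  ppD≡1+P = ℕ-Solver.solve (m ∷ j ∷ [])
  ppD≡m+1+q : 2 ℕ.* m ℕ.+ suc (suc j) ≡ m ℕ.+ suc (m ℕ.+ suc j)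
  ppD≡m+1+q = ℕ-Solver.solve (m ∷ j ∷ [])

  ftilde-A : ftilde (suc m) j x y ≡ sumTo (suc m) Aₜ
  ftilde-A = ftilde-as-sum (suc m) j x y ppA≡1+P (∸-≡ (suc m) q ppA≡1+m+q)

  ftilde-B : ftilde m (suc j) x y ≡ sumTo (suc m) Bₜ
  ftilde-B = trans (ftilde-as-sum m (suc j) x y refl (∸-≡ m q P≡m+q))
                   (sym (sumTo-last-zero m Bₜ (zero-*-* (X (suc m)) (Y (suc m)) (c-vanishes m (suc j) (suc m) ≤-refl))))

  ftilde-D : ftilde m (suc (suc j)) x y ≡ sumTo (suc m) Dₜ
  ftilde-D = trans (ftilde-as-sum m (suc (suc j)) x y ppD≡1+P (∸-≡ m (suc q) ppD≡m+1+q))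
                   (sym (sumTo-last-zero m Dₜ (zero-*-* (X′ (suc m)) (Y⁺ (suc m)) (c-vanishes m (suc (suc j)) (suc m) ≤-refl))))

  H-zero : H 0 ≡ 0ℚ
  H-zero = cong₂ _+_ (zero-*-* (X′ 0) (Y 0) refl) (ℚ.*-zeroʳ (⟦ 2 ⟧ * D 0 * X′ 0))

  H-end : H (suc (suc m)) ≡ 0ℚ
  H-end = cong₂ _+_ (zero-*-* (X′ (suc (suc m))) (Y (suc (suc m))) (c-vanishes m (suc j) (suc m) ≤-refl))
                    (trans (cong (λ z → ⟦ 2 ⟧ * z * X′ (suc (suc m)) * (Y⁺ (suc (suc m)) - Y (suc (suc m))))
                                 (c-vanishes m (suc (suc j)) (suc (suc m)) (n≤1+n (suc m))))
                           (zero-*-* (X′ (suc (suc m))) (Y⁺ (suc (suc m)) - Y (suc (suc m))) refl))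

  step : ∀ k → k ≤ suc m → E * Bₜ k - ⟦ 2 ⟧ * Dₜ k ≡ ρ * Aₜ k + (H (suc k) - H k)
  step k k≤1+m =
    telescoping-step E ξ η θ ρ (A k) (B k) (D k) (D (suc k)) (shift B k)
                     (X k) (X′ k) (Y k) (Y (suc k)) (Y⁺ k) (Y⁺ (suc k))
                     X′≡ξX (tildeY-suc q k y) (tildeY-suc-suc q k y)
                     (multiplier-identity x y ⟦ suc j ⟧ ⟦ m ⟧ ⟦ k ⟧ E ⟦ P ∸ k ⟧ ⟦ q ⟧ (B k) (D (suc k))
                                          E≡ N≡ (⟦⟧-+ m (suc j)) (c-absorption m (suc j) k k≤m+1+j))
                     (c-ibp m j k k≤1+m)
    where
    k≤P : k ≤ P
    k≤P = ≤-trans k≤1+m (subst (suc m ≤_) (sym P≡1+m+[m+j]) (m≤m+n (suc m) (m ℕ.+ j)))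
    k≤m+1+j : k ≤ m ℕ.+ suc j
    k≤m+1+j = ≤-trans k≤1+m (subst (suc m ≤_) (sym (+-suc m j)) (m≤m+n (suc m) j))
    ξ η θ : ℚ
    ξ = x * x - (⟦ P ∸ k ⟧ + 1ℚ) * (⟦ P ∸ k ⟧ + 1ℚ)
    η = y * y - (⟦ q ⟧ - ⟦ k ⟧) * (⟦ q ⟧ - ⟦ k ⟧)
    θ = y * y - (⟦ q ⟧ + 1ℚ) * (⟦ q ⟧ + 1ℚ)
    X′≡ξX : X′ k ≡ ξ * X k
    X′≡ξX = trans (cong (λ n → tildeX n x) (+-∸-assoc 1 k≤P)) (tildeX-suc (P ∸ k) x)
    1+j+m+1 : ⟦ suc j ℕ.+ m ℕ.+ 1 ⟧ ≡ ⟦ suc j ⟧ + ⟦ m ⟧ + 1ℚ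
    1+j+m+1 = trans (⟦⟧-+ (suc j ℕ.+ m) 1) (cong (_+ 1ℚ) (⟦⟧-+ (suc j) m))
    E≡ : E ≡ x * x + y * y - (⟦ suc j ⟧ + ⟦ m ⟧ + 1ℚ) * (⟦ suc j ⟧ + ⟦ m ⟧ + 1ℚ) - ⟦ suc j ⟧ * ⟦ suc j ⟧
    E≡ = cong₂ (λ a b → x * x + y * y - a - b)
               (trans (⟦⟧-* (suc j ℕ.+ m ℕ.+ 1) (suc j ℕ.+ m ℕ.+ 1)) (cong₂ _*_ 1+j+m+1 1+j+m+1))
               (⟦⟧-* (suc j) (suc j))
    N≡ : ⟦ P ∸ k ⟧ ≡ ⟦ 2 ⟧ * ⟦ m ⟧ + ⟦ suc j ⟧ - ⟦ k ⟧
    N≡ = trans (⟦⟧-∸ P k k≤P) (cong (_- ⟦ k ⟧) (trans (⟦⟧-+ (2 ℕ.* m) (suc j)) (cong (_+ ⟦ suc j ⟧) (⟦⟧-* 2 m))))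

proposition1 : (i m : ℕ) → 1 ≤ i → (x y : ℚ) →
    ((+ (2 ℕ.* i ∸ 1)) / suc (suc (2 ℕ.* m))) * ftilde (suc m) (i ∸ 1) x y
    ≡ (x * x + y * y - ⟦ (i ℕ.+ m ℕ.+ 1) ℕ.* (i ℕ.+ m ℕ.+ 1) ⟧ - ⟦ i ℕ.* i ⟧) * ftilde m i x y
    - ⟦ 2 ⟧ * ftilde m (suc i) x y
proposition1 (suc j) m (s≤s z≤n) x y = sym (begin
  E * ftilde m (suc j) x y - ⟦ 2 ⟧ * ftilde m (suc (suc j)) x y
    ≡⟨ cong₂ (λ u v → E * u - ⟦ 2 ⟧ * v) ftilde-B ftilde-D ⟩
  E * sumTo (suc m) Bₜ - ⟦ 2 ⟧ * sumTo (suc m) Dₜ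
    ≡⟨ cong₂ _-_ (sumTo-*ˡ (suc m) E Bₜ) (sumTo-*ˡ (suc m) ⟦ 2 ⟧ Dₜ) ⟩
  sumTo (suc m) (λ k → E * Bₜ k) - sumTo (suc m) (λ k → ⟦ 2 ⟧ * Dₜ k)
    ≡⟨ sumTo-sub (suc m) (λ k → E * Bₜ k) (λ k → ⟦ 2 ⟧ * Dₜ k) ⟨
  sumTo (suc m) (λ k → E * Bₜ k - ⟦ 2 ⟧ * Dₜ k)
    ≡⟨ sumTo-telescope (suc m) (λ k → E * Bₜ k - ⟦ 2 ⟧ * Dₜ k) (λ k → ρ * Aₜ k) H step ⟩
  sumTo (suc m) (λ k → ρ * Aₜ k) + (H (suc (suc m)) - H 0)
    ≡⟨ cong₂ (λ u v → sumTo (suc m) (λ k → ρ * Aₜ k) + (u - v)) H-end H-zero ⟩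
  sumTo (suc m) (λ k → ρ * Aₜ k) + 0ℚ
    ≡⟨ ℚ.+-identityʳ (sumTo (suc m) (λ k → ρ * Aₜ k)) ⟩
  sumTo (suc m) (λ k → ρ * Aₜ k)
    ≡⟨ sumTo-*ˡ (suc m) ρ Aₜ ⟨
  ρ * sumTo (suc m) Aₜ
    ≡⟨ cong (ρ *_) ftilde-A ⟨
  ρ * ftilde (suc m) j x y
    ∎)
  where open Recurrence m j x y
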